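{- Let $n \ge 4$ be an integer with $\{\log_2 n\} \ge \{\log_2 3\}$. If $r$ is a positive integer such that $\{\log_2 n\} < \frac{\lfloor r/2 \rfloor + 1}{r}$, then $\mathsf{D}_{\pm}(C_n^r) = \lfloor r \log_2 n \rfloor + 1$.
   Context: $C_n^r$ denotes the direct sum of $r$ copies of a cyclic group of order $n$; $\{x\} = x - \lfloor x\rfloor$ is the fractional part. For a finite abelian group $G$ (written additively), $\mathsf{D}_{\pm}(G)$ is the smallest positive integer $\ell$ such that for every sequence $g_1,\dots,g_k$ of elements of $G$ (repetitions allowed) with $k \ge \ell$ there exist a non-empty subset $I \subset \{1,\dots,k\}$ and $a_i \in \{+1,-1\}$ ($i\in I$) with $\sum_{i \in I} a_i g_i = 0$. -}

module Defs where

open import Data.Nat using (ℕ; zero; suc; _≤_; _<_; _≥_)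
open import Data.Fin using (Fin; toℕ) renaming (zero to fzero; suc to fsuc)
open import Data.Integer as ℤ using (ℤ; +_; 0ℤ)
open import Data.Integer.Divisibility using () renaming (_∣_ to _∣ℤ_)
open import Data.Product using (Σ; ∃; _×_)
open import Relation.Binary.PropositionalEquality using (_≡_)
open import Relation.Nullary using (¬_)

Cnr : ℕ → ℕ → Set
Cnr n r = Fin r → Fin n

-- Coefficient attached to each term: not chosen (i ∉ I), +1 or -1.
data Coef : Set where
  off plus minus : Coef

coefℤ : Coef → ℤ
coefℤ off   = 0ℤ
coefℤ plus  = ℤ.+ 1
coefℤ minus = ℤ.- (ℤ.+ 1)

sumℤ : (k : ℕ) → (Fin k → ℤ) → ℤ
sumℤ zero    f = 0ℤ
sumℤ (suc k) f = f fzero ℤ.+ sumℤ k (λ i → f (fsuc i))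

HasPlusMinusZeroSum : (n r k : ℕ) → (Fin k → Cnr n r) → Set
HasPlusMinusZeroSum n r k g =
  Σ (Fin k → Coef) λ a →
    (Σ (Fin k) λ i → ¬ (a i ≡ off)) ×
    ((j : Fin r) → (+ n) ∣ℤ sumℤ k (λ i → coefℤ (a i) ℤ.* (+ toℕ (g i j))))

PMGood : (n r ℓ : ℕ) → Set
PMGood n r ℓ = (k : ℕ) → k ≥ ℓ → (g : Fin k → Cnr n r) → HasPlusMinusZeroSum n r k g

DpmIs : (n r d : ℕ) → Set
DpmIs n r d = (1 ≤ d) × PMGood n r d × ((ℓ : ℕ) → 1 ≤ ℓ → ℓ < d → ¬ PMGood n r ℓ)

{-# OPTIONS --safe #-}
-- Upper bound: a sequence of length k with n^r < 2^k has two of its 2^k subset sums equal in C_n^r,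
-- and their difference is a ±-weighted zero sum.
-- Lower bound: write m = ⌊log₂ n⌋ and b = 2^(m-2). The powers 1, 2, …, 2^(m-1) in one coordinate
-- admit no ± zero sum: a signed sum of distinct powers of 2 vanishes only when all signs do, and
-- its absolute value is below 2^m ≤ n. In two coordinates take two binary blocks of length m-1
-- together with (b, 2b), (b, -2b), (3b, 2b): a nontrivial choice of signs on these three vectors
-- contributes cb with 2 ≤ |c| ≤ 4 in one of the coordinates, while the binary part contributes
-- less than 2b there; as 6b ≤ n (this is {log₂ n} ≥ {log₂ 3}) the total is nonzero modulo n.
-- Stacking ⌊r/2⌋ such pairs and, for odd r, one more binary block gives a ±-zero-sum-free
-- sequence of length r m + ⌊r/2⌋, which the hypothesis on {log₂ n} makes at least ⌊log₂ n^r⌋.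
module Submission where

open import Defs
open import Function using (_∘_)
open import Data.Product using (∃; ∃₂; _×_; _,_; proj₁; proj₂)
open import Data.Sum using (_⊎_; inj₁; inj₂)
open import Data.Fin using (Fin; zero; suc; toℕ; _↑ˡ_; _↑ʳ_; splitAt; fromℕ<; funToFin; finToFun; combine)
import Data.Fin.Properties as Fin
open import Data.Vec.Functional using (Vector; _++_; replicate; tail)
open import Data.Vec.Functional.Properties using (lookup-++ˡ; lookup-++ʳ)
import Data.Nat as ℕ
import Data.Nat.Properties as ℕ
open import Relation.Binary.PropositionalEquality
  using (_≡_; _≢_; _≗_; refl; sym; trans; cong; cong₂; subst; module ≡-Reasoning)
open import Relation.Nullary using (¬_; contradiction)

module SignedSums where

  open import Data.Integer using (ℤ; +_; +0; +[1+_]; -[1+_]; 0ℤ; -1ℤ; -_; _+_; _-_; _*_; ∣_∣; _%ℕ_; _/ℕ_)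
  open import Data.Integer.Properties
  open import Data.Integer.DivMod using (a≡a%ℕn+[a/ℕn]*n)
  open import Data.Integer.Divisibility.Signed
  open import Data.Integer.Tactic.RingSolver using (solve-∀)
  open import Algebra.Properties.Semiring.Sum +-*-semiring
    using (sum; sum-cong-≗; sum-replicate-zero; ∑-distrib-+; *-distribˡ-sum)
  open import Algebra.Properties.AbelianGroup +-0-abelianGroup using (inverseʳ-unique)
  import Data.Nat.Divisibility as ℕ

  private variable k k₁ k₂ n : ℕ.ℕ

  signedSum : Vector Coef k → Vector ℕ.ℕ k → ℤ
  signedSum c x = sum (λ i → coefℤ (c i) * + x i)

  sumℤ≡sum : ∀ k (f : Vector ℤ k) → sumℤ k f ≡ sum f
  sumℤ≡sum ℕ.zero    f = refl
  sumℤ≡sum (ℕ.suc k) f = cong (λ s → f zero + s) (sumℤ≡sum k (tail f))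

  sum-split : ∀ k₁ {k₂} (f : Vector ℤ (k₁ ℕ.+ k₂)) →
              sum f ≡ sum (f ∘ (_↑ˡ k₂)) + sum (f ∘ (k₁ ↑ʳ_))
  sum-split ℕ.zero    f = sym (+-identityˡ (sum f))
  sum-split (ℕ.suc k₁) f =
    trans (cong (λ s → f zero + s) (sum-split k₁ (tail f))) (sym (+-assoc (f zero) _ _))

  ∑-neg : ∀ (f : Vector ℤ k) → sum (λ i → - f i) ≡ - sum f
  ∑-neg f = begin
    sum (λ i → - f i)       ≡⟨ sum-cong-≗ (λ i → sym (-1*i≡-i (f i))) ⟩
    sum (λ i → -1ℤ * f i)   ≡⟨ sym (*-distribˡ-sum -1ℤ f) ⟩
    -1ℤ * sum f             ≡⟨ -1*i≡-i (sum f) ⟩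
    - sum f                 ∎
    where open ≡-Reasoning

  signedSum-cong : ∀ (c : Vector Coef k) {x y} → x ≗ y → signedSum c x ≡ signedSum c y
  signedSum-cong c x≗y = sum-cong-≗ (λ i → cong (λ v → coefℤ (c i) * + v) (x≗y i))

  signedSum-replicate-0 : ∀ (c : Vector Coef k) → signedSum c (replicate k 0) ≡ 0ℤ
  signedSum-replicate-0 {k} c = trans (sum-cong-≗ (λ i → *-zeroʳ (coefℤ (c i)))) (sum-replicate-zero k)

  signedSum-split : ∀ k₁ {k₂} (c : Vector Coef (k₁ ℕ.+ k₂)) x →
    signedSum c x ≡ signedSum (c ∘ (_↑ˡ k₂)) (x ∘ (_↑ˡ k₂)) + signedSum (c ∘ (k₁ ↑ʳ_)) (x ∘ (k₁ ↑ʳ_))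
  signedSum-split k₁ c x = sum-split k₁ _

  signedSum-off∷ : ∀ (c : Vector Coef (ℕ.suc k)) x → c zero ≡ off →
                   signedSum c x ≡ signedSum (tail c) (tail x)
  signedSum-off∷ c x c₀≡off =
    trans (cong (λ e → coefℤ e * + x zero + signedSum (tail c) (tail x)) c₀≡off) (+-identityˡ _)

  signedSum-scale : ∀ (c : Vector Coef k) m x → signedSum c (λ i → m ℕ.* x i) ≡ + m * signedSum c x
  signedSum-scale c m x =
    trans (sum-cong-≗ (λ i → step (coefℤ (c i)) (x i))) (sym (*-distribˡ-sum (+ m) (λ i → coefℤ (c i) * + x i)))
    where
    swap : ∀ e a v → e * (a * v) ≡ a * (e * v)
    swap = solve-∀
    step : ∀ e v → e * + (m ℕ.* v) ≡ + m * (e * + v)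
    step e v = trans (cong (e *_) (pos-* m v)) (swap e (+ m) (+ v))

  signedSum-difference : ∀ (c c₁ c₂ : Vector Coef k) x →
    (∀ i → coefℤ (c i) ≡ coefℤ (c₁ i) - coefℤ (c₂ i)) →
    signedSum c x ≡ signedSum c₁ x - signedSum c₂ x
  signedSum-difference c c₁ c₂ x coef≡ = begin
    signedSum c x
      ≡⟨ sum-cong-≗ (λ i → trans (cong (_* + x i) (coef≡ i)) (distrib (coefℤ (c₁ i)) (coefℤ (c₂ i)) (+ x i))) ⟩
    sum (λ i → coefℤ (c₁ i) * + x i + - (coefℤ (c₂ i) * + x i))
      ≡⟨ ∑-distrib-+ (λ i → coefℤ (c₁ i) * + x i) (λ i → - (coefℤ (c₂ i) * + x i)) ⟩
    signedSum c₁ x + sum (λ i → - (coefℤ (c₂ i) * + x i))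
      ≡⟨ cong (λ s → signedSum c₁ x + s) (∑-neg (λ i → coefℤ (c₂ i) * + x i)) ⟩
    signedSum c₁ x - signedSum c₂ x
      ∎
    where
    open ≡-Reasoning
    distrib : ∀ a b v → (a - b) * v ≡ a * v + - (b * v)
    distrib = solve-∀

  signedSum-∣- : ∀ (c : Vector Coef k) x y → (∀ i → + n ∣ + x i - + y i) →
                 + n ∣ signedSum c x - signedSum c y
  signedSum-∣- {ℕ.zero}  c x y _      = divides 0ℤ refl
  signedSum-∣- {ℕ.suc k} c x y n∣x-y =
    subst (_ ∣_) (sym (rearrange (coefℤ (c zero)) (+ x zero) (+ y zero) _ _))
      (∣m∣n⇒∣m+n (∣n⇒∣m*n (coefℤ (c zero)) (n∣x-y zero))
                 (signedSum-∣- (tail c) (tail x) (tail y) (n∣x-y ∘ suc)))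
    where
    rearrange : ∀ e a b s t → (e * a + s) - (e * b + t) ≡ e * (a - b) + (s - t)
    rearrange = solve-∀

  %ℕ-≡⇒∣- : ∀ i j .{{_ : ℕ.NonZero n}} → i %ℕ n ≡ j %ℕ n → + n ∣ i - j
  %ℕ-≡⇒∣- {n} i j i≡j = divides (i /ℕ n - j /ℕ n) (begin
    i - j
      ≡⟨ cong₂ _-_ (a≡a%ℕn+[a/ℕn]*n i n) (a≡a%ℕn+[a/ℕn]*n j n) ⟩
    (+ (i %ℕ n) + i /ℕ n * + n) - (+ (j %ℕ n) + j /ℕ n * + n)
      ≡⟨ cong (λ ρ → (+ (i %ℕ n) + i /ℕ n * + n) - (+ ρ + j /ℕ n * + n)) (sym i≡j) ⟩
    (+ (i %ℕ n) + i /ℕ n * + n) - (+ (i %ℕ n) + j /ℕ n * + n)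
      ≡⟨ cancel (+ (i %ℕ n)) (i /ℕ n) (j /ℕ n) (+ n) ⟩
    (i /ℕ n - j /ℕ n) * + n
      ∎)
    where
    open ≡-Reasoning
    cancel : ∀ ρ p q m → (ρ + p * m) - (ρ + q * m) ≡ (p - q) * m
    cancel = solve-∀

  pos-∸ : ∀ {m n} → n ℕ.≤ m → + (m ℕ.∸ n) ≡ + m - + n
  pos-∸ {m} {n} n≤m = trans (sym (⊖-≥ n≤m)) (sym (m-n≡m⊖n m n))

  small-multiple≡0 : ∀ {i} → ∣ i ∣ ℕ.< n → + n ∣ i → i ≡ 0ℤ
  small-multiple≡0 {i = +0}       _   _   = refl
  small-multiple≡0 {i = +[1+ _ ]} i<n n∣i = contradiction (∣⇒∣ᵤ n∣i) (ℕ.>⇒∤ i<n)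
  small-multiple≡0 {i = -[1+ _ ]} i<n n∣i = contradiction (∣⇒∣ᵤ n∣i) (ℕ.>⇒∤ i<n)

  ∣i∣<∣j∣⇒¬n∣i+j : ∀ {i j} → ∣ i ∣ ℕ.< ∣ j ∣ → ∣ i ∣ ℕ.+ ∣ j ∣ ℕ.< n → ¬ (+ n ∣ i + j)
  ∣i∣<∣j∣⇒¬n∣i+j {i = i} {j} i<j i+j<n n∣i+j = ℕ.<-irrefl ∣i∣≡∣j∣ i<j
    where
    j≡-i : j ≡ - i
    j≡-i = inverseʳ-unique i j (small-multiple≡0 (ℕ.≤-<-trans (∣i+j∣≤∣i∣+∣j∣ i j) i+j<n) n∣i+j)
    ∣i∣≡∣j∣ : ∣ i ∣ ≡ ∣ j ∣
    ∣i∣≡∣j∣ = trans (sym (∣-i∣≡∣i∣ i)) (cong ∣_∣ (sym j≡-i))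

  powers : Vector ℕ.ℕ k
  powers i = 2 ℕ.^ toℕ i

  signedSum-powers-suc : ∀ (c : Vector Coef (ℕ.suc k)) →
    signedSum c powers ≡ coefℤ (c zero) + + 2 * signedSum (tail c) powers
  signedSum-powers-suc c = cong₂ _+_ (*-identityʳ (coefℤ (c zero))) (signedSum-scale (tail c) 2 powers)

  ∣coefℤ∣≤1 : ∀ e → ∣ coefℤ e ∣ ℕ.≤ 1
  ∣coefℤ∣≤1 off   = ℕ.z≤n
  ∣coefℤ∣≤1 plus  = ℕ.≤-refl
  ∣coefℤ∣≤1 minus = ℕ.≤-refl

  ∣signedSum-powers∣<2^k : ∀ (c : Vector Coef k) → ∣ signedSum c powers ∣ ℕ.< 2 ℕ.^ k
  ∣signedSum-powers∣<2^k {ℕ.zero}  c = ℕ.s≤s ℕ.z≤n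
  ∣signedSum-powers∣<2^k {ℕ.suc k} c = begin-strict
    ∣ signedSum c powers ∣               ≡⟨ cong ∣_∣ (signedSum-powers-suc c) ⟩
    ∣ coefℤ (c zero) + + 2 * S ∣         ≤⟨ ∣i+j∣≤∣i∣+∣j∣ (coefℤ (c zero)) (+ 2 * S) ⟩
    ∣ coefℤ (c zero) ∣ ℕ.+ ∣ + 2 * S ∣   ≡⟨ cong (∣ coefℤ (c zero) ∣ ℕ.+_) (abs-* (+ 2) S) ⟩
    ∣ coefℤ (c zero) ∣ ℕ.+ 2 ℕ.* ∣ S ∣   ≤⟨ ℕ.+-monoˡ-≤ (2 ℕ.* ∣ S ∣) (∣coefℤ∣≤1 (c zero)) ⟩
    1 ℕ.+ 2 ℕ.* ∣ S ∣                    <⟨ ℕ.n<1+n _ ⟩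
    2 ℕ.+ 2 ℕ.* ∣ S ∣                    ≡⟨ sym (ℕ.*-suc 2 ∣ S ∣) ⟩
    2 ℕ.* ℕ.suc ∣ S ∣                    ≤⟨ ℕ.*-monoʳ-≤ 2 (∣signedSum-powers∣<2^k (tail c)) ⟩
    2 ℕ.^ ℕ.suc k                        ∎
    where
    open ℕ.≤-Reasoning
    S : ℤ
    S = signedSum (tail c) powers

  2∣coefℤ⇒≡off : ∀ e → + 2 ∣ coefℤ e → e ≡ off
  2∣coefℤ⇒≡off off   _   = refl
  2∣coefℤ⇒≡off plus  2∣e = contradiction (ℕ.∣1⇒≡1 (∣⇒∣ᵤ 2∣e)) λ ()
  2∣coefℤ⇒≡off minus 2∣e = contradiction (ℕ.∣1⇒≡1 (∣⇒∣ᵤ 2∣e)) λ ()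

  -- Parity: the lowest coefficient is the only odd term.
  signedSum-powers-suc≡0 : ∀ (c : Vector Coef (ℕ.suc k)) → signedSum c powers ≡ 0ℤ →
                           c zero ≡ off × signedSum (tail c) powers ≡ 0ℤ
  signedSum-powers-suc≡0 c eq = c₀≡off , *-cancelˡ-≡ (+ 2) S 0ℤ (trans 2S≡0 (sym (*-zeroʳ (+ 2))))
    where
    S : ℤ
    S = signedSum (tail c) powers
    split : coefℤ (c zero) + + 2 * S ≡ 0ℤ
    split = trans (sym (signedSum-powers-suc c)) eq
    c₀≡off : c zero ≡ off
    c₀≡off = 2∣coefℤ⇒≡off (c zero)
      (∣m+n∣n⇒∣m (subst (+ 2 ∣_) (sym split) (divides 0ℤ refl)) (∣m⇒∣m*n S ∣-refl))
    2S≡0 : + 2 * S ≡ 0ℤ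
    2S≡0 = trans (sym (+-identityˡ (+ 2 * S))) (subst (λ e → coefℤ e + + 2 * S ≡ 0ℤ) c₀≡off split)

  signedSum-powers≡0 : ∀ (c : Vector Coef k) → signedSum c powers ≡ 0ℤ → ∀ i → c i ≡ off
  signedSum-powers≡0 c eq zero    = proj₁ (signedSum-powers-suc≡0 c eq)
  signedSum-powers≡0 c eq (suc i) = signedSum-powers≡0 (tail c) (proj₂ (signedSum-powers-suc≡0 c eq)) i

open SignedSums

module HeadCoefficients where

  open import Data.Integer using (ℤ; +_; _+_; _-_; _*_; ∣_∣)
  open import Data.Integer.Properties using (abs-*)
  open import Data.Integer.Divisibility.Signed using (_∣_)
  open import Data.List using (List; _∷_; [])
  open import Data.List.Membership.Propositional using (_∈_)
  open import Data.List.Relation.Unary.Any using (here; there)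
  open import Data.List.Relation.Unary.All using (All; all?; lookup)
  open import Relation.Nullary using (Dec; yes; no)
  open import Relation.Nullary.Decidable using (_×-dec_; _⊎-dec_; from-yes)

  Gap : ℤ → Set
  Gap z = 2 ℕ.≤ ∣ z ∣ × ∣ z ∣ ℕ.≤ 4

  -- The multiples of b that signs e₁ e₂ e₃ on (b, 2b), (b, -2b), (3b, 2b) contribute to each coordinate.
  headCoefficient₁ headCoefficient₂ : Coef → Coef → Coef → ℤ
  headCoefficient₁ e₁ e₂ e₃ = coefℤ e₁ + coefℤ e₂ + + 3 * coefℤ e₃
  headCoefficient₂ e₁ e₂ e₃ = + 2 * (coefℤ e₁ - coefℤ e₂ + coefℤ e₃)

  HeadSeparated : Coef → Coef → Coef → Set
  HeadSeparated e₁ e₂ e₃ =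
    (e₁ ≡ off × e₂ ≡ off × e₃ ≡ off) ⊎ Gap (headCoefficient₁ e₁ e₂ e₃) ⊎ Gap (headCoefficient₂ e₁ e₂ e₃)

  off? : ∀ e → Dec (e ≡ off)
  off? off   = yes refl
  off? plus  = no λ ()
  off? minus = no λ ()

  gap? : ∀ z → Dec (Gap z)
  gap? z = 2 ℕ.≤? ∣ z ∣ ×-dec ∣ z ∣ ℕ.≤? 4

  headSeparated? : ∀ e₁ e₂ e₃ → Dec (HeadSeparated e₁ e₂ e₃)
  headSeparated? e₁ e₂ e₃ = (off? e₁ ×-dec off? e₂ ×-dec off? e₃) ⊎-dec
                            gap? (headCoefficient₁ e₁ e₂ e₃) ⊎-dec gap? (headCoefficient₂ e₁ e₂ e₃)

  coefs : List Coef
  coefs = off ∷ plus ∷ minus ∷ []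

  ∈-coefs : ∀ e → e ∈ coefs
  ∈-coefs off   = here refl
  ∈-coefs plus  = there (here refl)
  ∈-coefs minus = there (there (here refl))

  headSeparated : ∀ e₁ e₂ e₃ → HeadSeparated e₁ e₂ e₃
  headSeparated e₁ e₂ e₃ = lookup (lookup (lookup table (∈-coefs e₁)) (∈-coefs e₂)) (∈-coefs e₃)
    where
    table : All (λ e₁ → All (λ e₂ → All (HeadSeparated e₁ e₂) coefs) coefs) coefs
    table = from-yes (all? (λ e₁ → all? (λ e₂ → all? (headSeparated? e₁ e₂) coefs) coefs) coefs)

  ¬∣-gap : ∀ {b n B z} → 6 ℕ.* b ℕ.≤ n → ∣ B ∣ ℕ.< 2 ℕ.* b → Gap z → ¬ (+ n ∣ B + z * + b)
  ¬∣-gap {b} {n} {B} {z} 6b≤n B<2b (2≤z , z≤4) = ∣i∣<∣j∣⇒¬n∣i+j {i = B} {z * + b} B<zb B+zb<n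
    where
    open ℕ.≤-Reasoning
    B<zb : ∣ B ∣ ℕ.< ∣ z * + b ∣
    B<zb = begin-strict
      ∣ B ∣          <⟨ B<2b ⟩
      2 ℕ.* b        ≤⟨ ℕ.*-monoˡ-≤ b 2≤z ⟩
      ∣ z ∣ ℕ.* b    ≡⟨ sym (abs-* z (+ b)) ⟩
      ∣ z * + b ∣    ∎
    B+zb<n : ∣ B ∣ ℕ.+ ∣ z * + b ∣ ℕ.< n
    B+zb<n = begin-strict
      ∣ B ∣ ℕ.+ ∣ z * + b ∣        ≡⟨ cong (∣ B ∣ ℕ.+_) (abs-* z (+ b)) ⟩
      ∣ B ∣ ℕ.+ ∣ z ∣ ℕ.* b        <⟨ ℕ.+-monoˡ-< (∣ z ∣ ℕ.* b) B<2b ⟩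
      2 ℕ.* b ℕ.+ ∣ z ∣ ℕ.* b      ≤⟨ ℕ.+-monoʳ-≤ (2 ℕ.* b) (ℕ.*-monoˡ-≤ b z≤4) ⟩
      2 ℕ.* b ℕ.+ 4 ℕ.* b          ≡⟨ sym (ℕ.*-distribʳ-+ b 2 4) ⟩
      6 ℕ.* b                      ≤⟨ 6b≤n ⟩
      n                            ∎

  headCoefficients-off : ∀ {b n B₁ B₂} e₁ e₂ e₃ → 6 ℕ.* b ℕ.≤ n →
    ∣ B₁ ∣ ℕ.< 2 ℕ.* b → + n ∣ B₁ + headCoefficient₁ e₁ e₂ e₃ * + b →
    ∣ B₂ ∣ ℕ.< 2 ℕ.* b → + n ∣ B₂ + headCoefficient₂ e₁ e₂ e₃ * + b →
    e₁ ≡ off × e₂ ≡ off × e₃ ≡ off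
  headCoefficients-off {B₁ = B₁} {B₂} e₁ e₂ e₃ 6b≤n B₁<2b n∣₁ B₂<2b n∣₂ with headSeparated e₁ e₂ e₃
  ... | inj₁ offs        = offs
  ... | inj₂ (inj₁ gap₁) = contradiction n∣₁ (¬∣-gap {B = B₁} {headCoefficient₁ e₁ e₂ e₃} 6b≤n B₁<2b gap₁)
  ... | inj₂ (inj₂ gap₂) = contradiction n∣₂ (¬∣-gap {B = B₂} {headCoefficient₂ e₁ e₂ e₃} 6b≤n B₂<2b gap₂)

open HeadCoefficients

module ZeroSumFreeFamilies where

  open import Data.Integer using (ℤ; +_; 0ℤ; _+_; _-_; _*_)
  open import Data.Integer.Properties using (+-identityˡ; +-identityʳ; pos-*)
  open import Data.Integer.Divisibility.Signed using (_∣_; ∣ᵤ⇒∣; ∣m+n∣n⇒∣m; ∣m⇒∣-m; ∣n⇒∣m*n; ∣-refl)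
  open import Data.Integer.Tactic.RingSolver using (solve-∀)
  open import Data.Nat.DivMod using (_mod_; _%_; m%n%n≡m%n)
  open import Data.Vec.Functional using (_∷_; [])

  private variable k k₁ k₂ r r₁ r₂ n : ℕ.ℕ

  Family : ℕ.ℕ → ℕ.ℕ → Set
  Family k r = Vector (Vector ℕ.ℕ r) k

  column : Family k r → Fin r → Vector ℕ.ℕ k
  column v j i = v i j

  ZeroSumFree : ℕ.ℕ → Family k r → Set
  ZeroSumFree n v = ∀ c → (∀ j → + n ∣ signedSum c (column v j)) → ∀ i → c i ≡ off

  reduce : ∀ n .{{_ : ℕ.NonZero n}} → Family k r → Fin k → Cnr n r
  reduce n v i j = v i j mod n

  ZeroSumFree⇒¬HasPlusMinusZeroSum : ∀ .{{_ : ℕ.NonZero n}} (v : Family k r) →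
    ZeroSumFree n v → ¬ HasPlusMinusZeroSum n r k (reduce n v)
  ZeroSumFree⇒¬HasPlusMinusZeroSum {n} {k} v free (c , (i , cᵢ≢off) , n∣sums) = cᵢ≢off (free c n∣columns i)
    where
    reduced : Fin _ → Vector ℕ.ℕ k
    reduced j i = toℕ (reduce n v i j)
    n∣reduced : ∀ j → + n ∣ signedSum c (reduced j)
    n∣reduced j = subst (+ n ∣_) (sumℤ≡sum k _) (∣ᵤ⇒∣ (n∣sums j))
    n∣unreduced : ∀ j i → + n ∣ + v i j - + reduced j i
    n∣unreduced j i = %ℕ-≡⇒∣- (+ v i j) (+ reduced j i)
      (sym (trans (cong (_% n) (Fin.toℕ-fromℕ< _)) (m%n%n≡m%n (v i j) n)))
    n∣columns : ∀ j → + n ∣ signedSum c (column v j)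
    n∣columns j = ∣m+n∣n⇒∣m (signedSum-∣- c (column v j) (reduced j) (n∣unreduced j)) (∣m⇒∣-m (n∣reduced j))

  _⊕_ : Family k₁ r₁ → Family k₂ r₂ → Family (k₁ ℕ.+ k₂) (r₁ ℕ.+ r₂)
  _⊕_ {r₁ = r₁} {r₂ = r₂} v w = (λ i → v i ++ replicate r₂ 0) ++ (λ i → replicate r₁ 0 ++ w i)

  module _ (v : Family k₁ r₁) (w : Family k₂ r₂) where

    private
      left : Family k₁ (r₁ ℕ.+ r₂)
      left i = v i ++ replicate r₂ 0
      right : Family k₂ (r₁ ℕ.+ r₂)
      right i = replicate r₁ 0 ++ w i

    ⊕-↑ˡ-↑ˡ : ∀ i j → (v ⊕ w) (i ↑ˡ k₂) (j ↑ˡ r₂) ≡ v i j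
    ⊕-↑ˡ-↑ˡ i j = trans (cong (λ u → u (j ↑ˡ r₂)) (lookup-++ˡ left right i)) (lookup-++ˡ (v i) _ j)

    ⊕-↑ʳ-↑ˡ : ∀ i j → (v ⊕ w) (k₁ ↑ʳ i) (j ↑ˡ r₂) ≡ 0
    ⊕-↑ʳ-↑ˡ i j = trans (cong (λ u → u (j ↑ˡ r₂)) (lookup-++ʳ left right i)) (lookup-++ˡ (replicate r₁ 0) _ j)

    ⊕-↑ˡ-↑ʳ : ∀ i j → (v ⊕ w) (i ↑ˡ k₂) (r₁ ↑ʳ j) ≡ 0
    ⊕-↑ˡ-↑ʳ i j = trans (cong (λ u → u (r₁ ↑ʳ j)) (lookup-++ˡ left right i)) (lookup-++ʳ (v i) _ j)

    ⊕-↑ʳ-↑ʳ : ∀ i j → (v ⊕ w) (k₁ ↑ʳ i) (r₁ ↑ʳ j) ≡ w i j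
    ⊕-↑ʳ-↑ʳ i j = trans (cong (λ u → u (r₁ ↑ʳ j)) (lookup-++ʳ left right i)) (lookup-++ʳ (replicate r₁ 0) _ j)

    signedSum-⊕ˡ : ∀ c j → signedSum c (column (v ⊕ w) (j ↑ˡ r₂)) ≡ signedSum (c ∘ (_↑ˡ k₂)) (column v j)
    signedSum-⊕ˡ c j = begin
      signedSum c (column (v ⊕ w) (j ↑ˡ r₂))
        ≡⟨ signedSum-split k₁ c (column (v ⊕ w) (j ↑ˡ r₂)) ⟩
      signedSum (c ∘ (_↑ˡ k₂)) (λ i → (v ⊕ w) (i ↑ˡ k₂) (j ↑ˡ r₂)) +
      signedSum (c ∘ (k₁ ↑ʳ_)) (λ i → (v ⊕ w) (k₁ ↑ʳ i) (j ↑ˡ r₂))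
        ≡⟨ cong₂ _+_ (signedSum-cong (c ∘ (_↑ˡ k₂)) (λ i → ⊕-↑ˡ-↑ˡ i j))
                     (trans (signedSum-cong (c ∘ (k₁ ↑ʳ_)) (λ i → ⊕-↑ʳ-↑ˡ i j))
                            (signedSum-replicate-0 (c ∘ (k₁ ↑ʳ_)))) ⟩
      signedSum (c ∘ (_↑ˡ k₂)) (column v j) + 0ℤ
        ≡⟨ +-identityʳ (signedSum (c ∘ (_↑ˡ k₂)) (column v j)) ⟩
      signedSum (c ∘ (_↑ˡ k₂)) (column v j)
        ∎
      where open ≡-Reasoning

    signedSum-⊕ʳ : ∀ c j → signedSum c (column (v ⊕ w) (r₁ ↑ʳ j)) ≡ signedSum (c ∘ (k₁ ↑ʳ_)) (column w j)
    signedSum-⊕ʳ c j = begin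
      signedSum c (column (v ⊕ w) (r₁ ↑ʳ j))
        ≡⟨ signedSum-split k₁ c (column (v ⊕ w) (r₁ ↑ʳ j)) ⟩
      signedSum (c ∘ (_↑ˡ k₂)) (λ i → (v ⊕ w) (i ↑ˡ k₂) (r₁ ↑ʳ j)) +
      signedSum (c ∘ (k₁ ↑ʳ_)) (λ i → (v ⊕ w) (k₁ ↑ʳ i) (r₁ ↑ʳ j))
        ≡⟨ cong₂ _+_ (trans (signedSum-cong (c ∘ (_↑ˡ k₂)) (λ i → ⊕-↑ˡ-↑ʳ i j))
                            (signedSum-replicate-0 (c ∘ (_↑ˡ k₂))))
                     (signedSum-cong (c ∘ (k₁ ↑ʳ_)) (λ i → ⊕-↑ʳ-↑ʳ i j)) ⟩
      0ℤ + signedSum (c ∘ (k₁ ↑ʳ_)) (column w j)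
        ≡⟨ +-identityˡ (signedSum (c ∘ (k₁ ↑ʳ_)) (column w j)) ⟩
      signedSum (c ∘ (k₁ ↑ʳ_)) (column w j)
        ∎
      where open ≡-Reasoning

  ↑-elim : ∀ {P : Fin (k₁ ℕ.+ k₂) → Set} → (∀ i → P (i ↑ˡ k₂)) → (∀ i → P (k₁ ↑ʳ i)) → ∀ i → P i
  ↑-elim {k₁} {P = P} left right i with splitAt k₁ i in eq
  ... | inj₁ i₁ = subst P (Fin.splitAt⁻¹-↑ˡ eq) (left i₁)
  ... | inj₂ i₂ = subst P (Fin.splitAt⁻¹-↑ʳ eq) (right i₂)

  ZeroSumFree-⊕ : ∀ {v : Family k₁ r₁} {w : Family k₂ r₂} →
                  ZeroSumFree n v → ZeroSumFree n w → ZeroSumFree n (v ⊕ w)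
  ZeroSumFree-⊕ {k₁} {r₁} {k₂} {r₂} {n} {v} {w} v-free w-free c n∣columns =
    ↑-elim (v-free (c ∘ (_↑ˡ k₂)) (λ j → subst (+ n ∣_) (signedSum-⊕ˡ v w c j) (n∣columns (j ↑ˡ r₂))))
           (w-free (c ∘ (k₁ ↑ʳ_)) (λ j → subst (+ n ∣_) (signedSum-⊕ʳ v w c j) (n∣columns (r₁ ↑ʳ j))))

  powersFamily : Family k 1
  powersFamily i _ = powers i

  powersFamily-free : 2 ℕ.^ k ℕ.≤ n → ZeroSumFree n (powersFamily {k})
  powersFamily-free 2^k≤n c n∣sum =
    signedSum-powers≡0 c (small-multiple≡0 (ℕ.<-≤-trans (∣signedSum-powers∣<2^k c) 2^k≤n) (n∣sum zero))

  module TwoBlock (n u : ℕ.ℕ) where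

    b : ℕ.ℕ
    b = 2 ℕ.^ u

    t : ℕ.ℕ
    t = ℕ.suc u

    binaryPair : Family (t ℕ.+ t) 2
    binaryPair = powersFamily {t} ⊕ powersFamily {t}

    -- n ∸ 2b represents -2b modulo n.
    block : Family (3 ℕ.+ (t ℕ.+ t)) 2
    block = (b ∷ 2 ℕ.* b ∷ []) ∷ (b ∷ n ℕ.∸ 2 ℕ.* b ∷ []) ∷ (3 ℕ.* b ∷ 2 ℕ.* b ∷ []) ∷ binaryPair

    module _ (c : Vector Coef (3 ℕ.+ (t ℕ.+ t))) where

      e₁ e₂ e₃ : Coef
      e₁ = c zero
      e₂ = c (suc zero)
      e₃ = c (suc (suc zero))

      d : Vector Coef (t ℕ.+ t)
      d i = c (suc (suc (suc i)))

      d₁ d₂ : Vector Coef t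
      d₁ i = d (i ↑ˡ t)
      d₂ i = d (t ↑ʳ i)

      B₁ B₂ : ℤ
      B₁ = signedSum d₁ powers
      B₂ = signedSum d₂ powers

      column₀-sum : signedSum c (column block zero) ≡ B₁ + headCoefficient₁ e₁ e₂ e₃ * + b
      column₀-sum = begin
        coefℤ e₁ * + b + (coefℤ e₂ * + b + (coefℤ e₃ * + (3 ℕ.* b) + signedSum d (column binaryPair zero)))
          ≡⟨ cong₂ (λ x y → coefℤ e₁ * + b + (coefℤ e₂ * + b + (coefℤ e₃ * x + y)))
                   (pos-* 3 b) (signedSum-⊕ˡ (powersFamily {t}) (powersFamily {t}) d zero) ⟩
        coefℤ e₁ * + b + (coefℤ e₂ * + b + (coefℤ e₃ * (+ 3 * + b) + B₁))
          ≡⟨ collect (coefℤ e₁) (coefℤ e₂) (coefℤ e₃) (+ b) B₁ ⟩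
        B₁ + headCoefficient₁ e₁ e₂ e₃ * + b
          ∎
        where
        open ≡-Reasoning
        collect : ∀ x₁ x₂ x₃ β B → x₁ * β + (x₂ * β + (x₃ * (+ 3 * β) + B)) ≡ B + (x₁ + x₂ + + 3 * x₃) * β
        collect = solve-∀

      column₁-sum : 2 ℕ.* b ℕ.≤ n →
        signedSum c (column block (suc zero)) ≡ B₂ + headCoefficient₂ e₁ e₂ e₃ * + b + coefℤ e₂ * + n
      column₁-sum 2b≤n = begin
        coefℤ e₁ * + (2 ℕ.* b) + (coefℤ e₂ * + (n ℕ.∸ 2 ℕ.* b) +
          (coefℤ e₃ * + (2 ℕ.* b) + signedSum d (column binaryPair (suc zero))))
          ≡⟨ cong₂ (λ x y → coefℤ e₁ * x + (coefℤ e₂ * y + (coefℤ e₃ * x + signedSum d (column binaryPair (suc zero)))))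
                   (pos-* 2 b) (trans (pos-∸ 2b≤n) (cong (λ x → + n - x) (pos-* 2 b))) ⟩
        coefℤ e₁ * (+ 2 * + b) + (coefℤ e₂ * (+ n - + 2 * + b) +
          (coefℤ e₃ * (+ 2 * + b) + signedSum d (column binaryPair (suc zero))))
          ≡⟨ cong (λ y → coefℤ e₁ * (+ 2 * + b) + (coefℤ e₂ * (+ n - + 2 * + b) + (coefℤ e₃ * (+ 2 * + b) + y)))
                  (signedSum-⊕ʳ (powersFamily {t}) (powersFamily {t}) d zero) ⟩
        coefℤ e₁ * (+ 2 * + b) + (coefℤ e₂ * (+ n - + 2 * + b) + (coefℤ e₃ * (+ 2 * + b) + B₂))
          ≡⟨ collect (coefℤ e₁) (coefℤ e₂) (coefℤ e₃) (+ b) (+ n) B₂ ⟩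
        B₂ + headCoefficient₂ e₁ e₂ e₃ * + b + coefℤ e₂ * + n
          ∎
        where
        open ≡-Reasoning
        collect : ∀ x₁ x₂ x₃ β ν B →
          x₁ * (+ 2 * β) + (x₂ * (ν - + 2 * β) + (x₃ * (+ 2 * β) + B)) ≡ B + + 2 * (x₁ - x₂ + x₃) * β + x₂ * ν
        collect = solve-∀

    free : 6 ℕ.* b ℕ.≤ n → ZeroSumFree n block
    free 6b≤n c n∣columns = allOff
      where
      2b≤n : 2 ℕ.* b ℕ.≤ n
      2b≤n = ℕ.≤-trans (ℕ.*-monoˡ-≤ b {2} {6} (ℕ.s≤s (ℕ.s≤s ℕ.z≤n))) 6b≤n
      n∣₁ : + n ∣ B₁ c + headCoefficient₁ (e₁ c) (e₂ c) (e₃ c) * + b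
      n∣₁ = subst (+ n ∣_) (column₀-sum c) (n∣columns zero)
      n∣₂ : + n ∣ B₂ c + headCoefficient₂ (e₁ c) (e₂ c) (e₃ c) * + b
      n∣₂ = ∣m+n∣n⇒∣m (subst (+ n ∣_) (column₁-sum c 2b≤n) (n∣columns (suc zero)))
                      (∣n⇒∣m*n (coefℤ (e₂ c)) ∣-refl)
      head-off : e₁ c ≡ off × e₂ c ≡ off × e₃ c ≡ off
      head-off = headCoefficients-off {b = b} {B₁ = B₁ c} {B₂ c} (e₁ c) (e₂ c) (e₃ c) 6b≤n
        (∣signedSum-powers∣<2^k (d₁ c)) n∣₁ (∣signedSum-powers∣<2^k (d₂ c)) n∣₂
      drop-head : ∀ j → signedSum c (column block j) ≡ signedSum (d c) (column binaryPair j)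
      drop-head j = trans (signedSum-off∷ c x (proj₁ head-off))
                   (trans (signedSum-off∷ (tail c) (tail x) (proj₁ (proj₂ head-off)))
                          (signedSum-off∷ (tail (tail c)) (tail (tail x)) (proj₂ (proj₂ head-off))))
        where
        x : Vector ℕ.ℕ (3 ℕ.+ (t ℕ.+ t))
        x = column block j
      binaryPair-free : ZeroSumFree n binaryPair
      binaryPair-free = ZeroSumFree-⊕ (powersFamily-free {t} 2b≤n) (powersFamily-free {t} 2b≤n)
      allOff : ∀ i → c i ≡ off
      allOff zero                = proj₁ head-off
      allOff (suc zero)          = proj₁ (proj₂ head-off)
      allOff (suc (suc zero))    = proj₂ (proj₂ head-off)
      allOff (suc (suc (suc i))) = binaryPair-free (d c) (λ j → subst (+ n ∣_) (drop-head j) (n∣columns j)) i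

open ZeroSumFreeFamilies

module Pigeonhole where

  open import Data.Integer using (ℤ; +_; _-_; _*_; _%ℕ_)
  open import Data.Integer.DivMod using (n%ℕd<d)
  import Data.Integer.Divisibility as Unsigned
  open import Data.Integer.Divisibility.Signed using (∣⇒∣ᵤ)

  private variable k m n r : ℕ.ℕ

  funToFin-cong : ∀ {f g : Fin k → Fin m} → f ≗ g → funToFin f ≡ funToFin g
  funToFin-cong {ℕ.zero}  _   = refl
  funToFin-cong {ℕ.suc k} f≗g = cong₂ combine (f≗g zero) (funToFin-cong (f≗g ∘ suc))

  pigeonhole-functions : n ℕ.^ r ℕ.< m ℕ.^ k → (F : (Fin k → Fin m) → (Fin r → Fin n)) →
                         ∃₂ λ a b → (∃ λ i → a i ≢ b i) × F a ≗ F b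
  pigeonhole-functions {n} {r} {m} {k} n^r<m^k F
    with x , y , x<y , Fx≡Fy ← Fin.pigeonhole n^r<m^k (funToFin ∘ F ∘ finToFun)
    = a , b , Fin.¬∀⟶∃¬ k _ (λ i → a i Fin.≟ b i) a≉b , Fa≗Fb
    where
    a b : Fin k → Fin m
    a = finToFun x
    b = finToFun y
    Fa≗Fb : F a ≗ F b
    Fa≗Fb j = begin
      F a j                       ≡⟨ sym (Fin.finToFun-funToFin (F a) j) ⟩
      finToFun (funToFin (F a)) j ≡⟨ cong (λ z → finToFun z j) Fx≡Fy ⟩
      finToFun (funToFin (F b)) j ≡⟨ Fin.finToFun-funToFin (F b) j ⟩
      F b j                       ∎
      where open ≡-Reasoning
    a≉b : ¬ (∀ i → a i ≡ b i)
    a≉b a≗b = Fin.<⇒≢ x<y (begin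
      x           ≡⟨ sym (Fin.funToFin-finToFin {k} {m} x) ⟩
      funToFin a  ≡⟨ funToFin-cong a≗b ⟩
      funToFin b  ≡⟨ Fin.funToFin-finToFin {k} {m} y ⟩
      y           ∎)
      where open ≡-Reasoning

  select : Fin 2 → Coef
  select zero       = off
  select (suc zero) = plus

  difference : Fin 2 → Fin 2 → Coef
  difference zero       zero       = off
  difference zero       (suc zero) = minus
  difference (suc zero) zero       = plus
  difference (suc zero) (suc zero) = off

  coefℤ-difference : ∀ p q → coefℤ (difference p q) ≡ coefℤ (select p) - coefℤ (select q)
  coefℤ-difference zero       zero       = refl
  coefℤ-difference zero       (suc zero) = refl
  coefℤ-difference (suc zero) zero       = refl
  coefℤ-difference (suc zero) (suc zero) = refl

  difference≢off : ∀ {p q} → p ≢ q → difference p q ≢ off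
  difference≢off {zero}     {zero}     p≢q _ = p≢q refl
  difference≢off {suc zero} {suc zero} p≢q _ = p≢q refl
  difference≢off {zero}     {suc zero} _   ()
  difference≢off {suc zero} {zero}     _   ()

  values : (Fin k → Cnr n r) → Fin r → Vector ℕ.ℕ k
  values g j i = toℕ (g i j)

  subsetSum : .{{_ : ℕ.NonZero n}} → (Fin k → Cnr n r) → (Fin k → Fin 2) → Cnr n r
  subsetSum {n = n} g a j = fromℕ< (n%ℕd<d (signedSum (select ∘ a) (values g j)) n)

  n^r<2^k⇒hasPlusMinusZeroSum : ∀ .{{_ : ℕ.NonZero n}} → n ℕ.^ r ℕ.< 2 ℕ.^ k →
                                (g : Fin k → Cnr n r) → HasPlusMinusZeroSum n r k g
  n^r<2^k⇒hasPlusMinusZeroSum {n} {r} {k} n^r<2^k g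
    with a , b , (i , aᵢ≢bᵢ) , same ← pigeonhole-functions n^r<2^k (subsetSum g)
    = (λ i → difference (a i) (b i)) , (i , difference≢off aᵢ≢bᵢ) , n∣difference
    where
    n∣difference : ∀ j → + n Unsigned.∣ sumℤ k (λ i → coefℤ (difference (a i) (b i)) * + values g j i)
    n∣difference j =
      subst (+ n Unsigned.∣_)
        (sym (trans (sumℤ≡sum k _) (signedSum-difference c (select ∘ a) (select ∘ b) (values g j) (λ i → coefℤ-difference (a i) (b i)))))
        (∣⇒∣ᵤ (%ℕ-≡⇒∣- (sub a) (sub b) (Fin.fromℕ<-injective _ _ _ _ (same j))))
      where
      c : Vector Coef k
      c i = difference (a i) (b i)
      sub : (Fin k → Fin 2) → ℤ
      sub a = signedSum (select ∘ a) (values g j)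

open Pigeonhole

open import Data.Nat using (ℕ; zero; suc; _+_; _*_; _^_; _≤_; _<_; _/_; z≤n; s≤s; s≤s⁻¹; NonZero; >-nonZero; ⌊_/2⌋; ⌈_/2⌉)
open import Data.Nat.Properties
open import Data.Nat.Logarithm using (⌊log₂_⌋; ⌊log₂⌋-mono-≤; ⌊log₂[2^n]⌋≡n)
open import Data.Nat.Logarithm.Core using (⌊log2⌋)
open import Data.Nat.DivMod using (m/n≡1+[m∸n]/n)
open import Data.Nat.Tactic.RingSolver using (solve-∀)
open import Induction.WellFounded using (Acc; acc)

2^⌊log2⌋≤n : ∀ n .{{_ : NonZero n}} (rec : Acc _<_ n) → 2 ^ ⌊log2⌋ n rec ≤ n
2^⌊log2⌋≤n 1             _        = ≤-refl
2^⌊log2⌋≤n (suc (suc n)) (acc rs) = begin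
  2 * 2 ^ ⌊log2⌋ (suc h) _  ≤⟨ *-monoʳ-≤ 2 (2^⌊log2⌋≤n (suc h) (rs (⌊n/2⌋<n (suc n)))) ⟩
  2 * suc h                 ≡⟨ *-suc 2 h ⟩
  2 + (h + (h + 0))         ≡⟨ cong (λ m → 2 + (h + m)) (+-identityʳ h) ⟩
  2 + (h + h)               ≤⟨ +-monoʳ-≤ 2 (+-monoʳ-≤ h (⌊n/2⌋≤⌈n/2⌉ n)) ⟩
  2 + (h + ⌈ n /2⌉)         ≡⟨ cong (2 +_) (⌊n/2⌋+⌈n/2⌉≡n n) ⟩
  2 + n                     ∎
  where
  open ≤-Reasoning
  h : ℕ
  h = ⌊ n /2⌋

2^⌊log₂n⌋≤n : ∀ n .{{_ : NonZero n}} → 2 ^ ⌊log₂ n ⌋ ≤ n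
2^⌊log₂n⌋≤n n = 2^⌊log2⌋≤n n _

2^m≤n⇒m≤⌊log₂n⌋ : ∀ {m n} → 2 ^ m ≤ n → m ≤ ⌊log₂ n ⌋
2^m≤n⇒m≤⌊log₂n⌋ {m} {n} 2^m≤n = subst (_≤ ⌊log₂ n ⌋) (⌊log₂[2^n]⌋≡n m) (⌊log₂⌋-mono-≤ 2^m≤n)

n<2^[1+⌊log₂n⌋] : ∀ n → n < 2 ^ suc ⌊log₂ n ⌋
n<2^[1+⌊log₂n⌋] n = ≰⇒> (λ 2^[1+L]≤n → n≮n _ (2^m≤n⇒m≤⌊log₂n⌋ 2^[1+L]≤n))

n<2^[1+m]⇒⌊log₂n⌋≤m : ∀ {n m} → n < 2 ^ suc m → ⌊log₂ n ⌋ ≤ m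
n<2^[1+m]⇒⌊log₂n⌋≤m {zero}  _        = z≤n
n<2^[1+m]⇒⌊log₂n⌋≤m {suc n} n<2^[1+m] =
  ≮⇒≥ (λ m<L → <⇒≱ n<2^[1+m] (≤-trans (^-monoʳ-≤ 2 m<L) (2^⌊log₂n⌋≤n (suc n))))

freeFamilyLength : ℕ → ℕ → ℕ
freeFamilyLength u zero          = zero
freeFamilyLength u (suc zero)    = 2 + u
freeFamilyLength u (suc (suc r)) = (3 + (suc u + suc u)) + freeFamilyLength u r

freeFamilyLength≡ : ∀ u r → freeFamilyLength u r ≡ r * (2 + u) + r / 2
freeFamilyLength≡ u zero          = refl
freeFamilyLength≡ u (suc zero)    = sym (trans (+-identityʳ (1 * (2 + u))) (*-identityˡ (2 + u)))
freeFamilyLength≡ u (suc (suc r)) = begin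
  (3 + (suc u + suc u)) + freeFamilyLength u r   ≡⟨ cong ((3 + (suc u + suc u)) +_) (freeFamilyLength≡ u r) ⟩
  (3 + (suc u + suc u)) + (r * (2 + u) + r / 2)  ≡⟨ regroup u r (r / 2) ⟩
  (2 + r) * (2 + u) + (1 + r / 2)                ≡⟨ cong ((2 + r) * (2 + u) +_) (sym (m/n≡1+[m∸n]/n {2 + r} (s≤s (s≤s z≤n)))) ⟩
  (2 + r) * (2 + u) + (2 + r) / 2                ∎
  where
  open ≡-Reasoning
  regroup : ∀ u r h → (3 + (suc u + suc u)) + (r * (2 + u) + h) ≡ (2 + r) * (2 + u) + (1 + h)
  regroup = solve-∀

freeFamily : ∀ n u r → Family (freeFamilyLength u r) r
freeFamily n u zero          = λ ()
freeFamily n u (suc zero)    = powersFamily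
freeFamily n u (suc (suc r)) = TwoBlock.block n u ⊕ freeFamily n u r

freeFamily-free : ∀ {n u} → 6 * 2 ^ u ≤ n → ∀ r → ZeroSumFree n (freeFamily n u r)
freeFamily-free 6b≤n zero          c _ ()
freeFamily-free {n} {u} 6b≤n (suc zero) = powersFamily-free (begin
  2 * (2 * 2 ^ u)  ≡⟨ sym (*-assoc 2 2 (2 ^ u)) ⟩
  4 * 2 ^ u        ≤⟨ *-monoˡ-≤ (2 ^ u) {4} {6} (s≤s (s≤s (s≤s (s≤s z≤n)))) ⟩
  6 * 2 ^ u        ≤⟨ 6b≤n ⟩
  n                ∎)
  where open ≤-Reasoning
freeFamily-free 6b≤n (suc (suc r)) = ZeroSumFree-⊕ (TwoBlock.free _ _ 6b≤n) (freeFamily-free 6b≤n r)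

bounds⇒DpmIs : ∀ {n r L K} (g : Fin K → Cnr n r) → L ≤ K → ¬ HasPlusMinusZeroSum n r K g →
               PMGood n r (suc L) → DpmIs n r (suc L)
bounds⇒DpmIs g L≤K g-free long⇒zeroSum =
  s≤s z≤n , long⇒zeroSum , λ ℓ _ ℓ<1+L ℓ-good → g-free (ℓ-good _ (≤-trans (s≤s⁻¹ ℓ<1+L) L≤K) g)

DpmIs-⌊log₂[n^r]⌋+1 : ∀ n r u → 6 * 2 ^ u ≤ n → n ^ r < 2 ^ (r * (2 + u) + r / 2 + 1) →
                      DpmIs n r (⌊log₂ (n ^ r) ⌋ + 1)
DpmIs-⌊log₂[n^r]⌋+1 n r u 6b≤n n^r<2^[K+1] =
  subst (DpmIs n r) (+-comm 1 L)
    (bounds⇒DpmIs (reduce n v) L≤K (ZeroSumFree⇒¬HasPlusMinusZeroSum v (freeFamily-free 6b≤n r)) long⇒zeroSum)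
  where
  instance
    n-nonZero : NonZero n
    n-nonZero = >-nonZero (<-≤-trans (m^n>0 2 u) (≤-trans (m≤n*m (2 ^ u) 6) 6b≤n))
  L : ℕ
  L = ⌊log₂ (n ^ r) ⌋
  v : Family (freeFamilyLength u r) r
  v = freeFamily n u r
  L≤K : L ≤ freeFamilyLength u r
  L≤K = subst (L ≤_) (sym (freeFamilyLength≡ u r))
          (n<2^[1+m]⇒⌊log₂n⌋≤m (subst (λ e → n ^ r < 2 ^ e) (+-comm (r * (2 + u) + r / 2) 1) n^r<2^[K+1]))
  long⇒zeroSum : PMGood n r (suc L)
  long⇒zeroSum k 1+L≤k = n^r<2^k⇒hasPlusMinusZeroSum (<-≤-trans (n<2^[1+⌊log₂n⌋] (n ^ r)) (^-monoʳ-≤ 2 1+L≤k))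

theorem4p3 : (n r : ℕ) → 4 ≤ n →
    -- {log₂ n} ≥ {log₂ 3}  ⇔  3 · 2^⌊log₂ n⌋ ≤ 2n
    3 * 2 ^ ⌊log₂ n ⌋ ≤ 2 * n →
    1 ≤ r →
    -- {log₂ n} < (⌊r/2⌋+1)/r  ⇔  n^r < 2^(r⌊log₂ n⌋ + ⌊r/2⌋ + 1)
    n ^ r < 2 ^ (r * ⌊log₂ n ⌋ + r / 2 + 1) →
    -- ⌊r log₂ n⌋ = ⌊log₂ (n^r)⌋
    DpmIs n r (⌊log₂ (n ^ r) ⌋ + 1)
theorem4p3 n r 4≤n 3·2^m≤2n _ with ⌊log₂ n ⌋ | 2^m≤n⇒m≤⌊log₂n⌋ {2} 4≤n
... | suc zero    | s≤s ()
... | suc (suc u) | _ = DpmIs-⌊log₂[n^r]⌋+1 n r u (*-cancelˡ-≤ 2 (subst (_≤ 2 * n) (regroup (2 ^ u)) 3·2^m≤2n))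
  where
  regroup : ∀ b → 3 * (2 * (2 * b)) ≡ 2 * (6 * b)
  regroup = solve-∀
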